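{- Let $\mathbb{K}$ be a semiring and $f\colon\mathbb{N}^d\to\mathbb{K}$. If $f$ is $\boldsymbol{\mathcal{S}}$-automatic then $\ker_{\boldsymbol{\mathcal{S}}}(f)$ is finite. If each $L_i$ ($1\le i\le d$) is prefix-closed and $\ker_{\boldsymbol{\mathcal{S}}}(f)$ is finite, then $f$ is $\boldsymbol{\mathcal{S}}$-automatic.
   Context: An abstract numeration system is a triple $\mathcal{S}=(L,A,<)$ where $L$ is an infinite regular language over a finite alphabet $A$ totally ordered by $<$. Words are ordered by the radix order ($u<_{\rm rad}v$ iff $|u|<|v|$, or $|u|=|v|$ and $u$ is lexicographically smaller); $\mathrm{rep}_{\mathcal{S}}\colon\mathbb{N}\to L$ maps $n$ to the $n$-th word of $L$ (indexing from $0$) and $\mathrm{val}_{\mathcal{S}}$ is its inverse. Fix $d\ge1$, abstract numeration systems $\mathcal{S}_i=(L_i,A_i,<_i)$ for $i\in\{1,\dots,d\}$, $\boldsymbol{\mathcal{S}}=(\mathcal{S}_1,\dots,\mathcal{S}_d)$, and a symbol $\#\notin A_1\cup\dots\cup A_d$. Let $\boldsymbol{\#}=(\#,\dots,\#)$ and $\boldsymbol{A}=\big((A_1\cup\{\#\})\times\cdots\times(A_d\cup\{\#\})\big)\setminus\{\boldsymbol{\#}\}$. For words $w_1,\dots,w_d$, $(w_1,\dots,w_d)^\#$ is the word over $\boldsymbol{A}$ obtained by left-padding each $w_i$ with $\#$'s to the maximal length and reading them in parallel. Let $\boldsymbol{L}=\{(w_1,\dots,w_d)^\#: w_i\in L_i\}$,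 $\mathrm{rep}_{\boldsymbol{\mathcal{S}}}(n_1,\dots,n_d)=(\mathrm{rep}_{\mathcal{S}_1}(n_1),\dots,\mathrm{rep}_{\mathcal{S}_d}(n_d))^\#$ (a bijection $\mathbb{N}^d\to\boldsymbol{L}$), $\mathrm{val}_{\boldsymbol{\mathcal{S}}}$ its inverse. A sequence $f\colon\mathbb{N}^d\to\mathbb{K}$ is $\boldsymbol{\mathcal{S}}$-automatic if there is a deterministic finite automaton with output $(Q,q_0,\delta,\boldsymbol{A},\tau,\Delta)$ with finite output alphabet $\Delta\subseteq\mathbb{K}$ such that $f(\boldsymbol{n})=\tau(\delta(q_0,\mathrm{rep}_{\boldsymbol{\mathcal{S}}}(\boldsymbol{n})))$ for all $\boldsymbol{n}\in\mathbb{N}^d$. For $\boldsymbol{w}\in\boldsymbol{A}^*$, $(f\circ\boldsymbol{w})(\boldsymbol{n})=f(\mathrm{val}_{\boldsymbol{\mathcal{S}}}(\mathrm{rep}_{\boldsymbol{\mathcal{S}}}(\boldsymbol{n})\boldsymbol{w}))$ if the concatenation $\mathrm{rep}_{\boldsymbol{\mathcal{S}}}(\boldsymbol{n})\boldsymbol{w}$ lies in $\boldsymbol{L}$, and $0$ otherwise; the $\boldsymbol{\mathcal{S}}$-kernel of $f$ is $\ker_{\boldsymbol{\mathcal{S}}}(f)=\{f\circ\boldsymbol{w}:\boldsymbol{w}\in\boldsymbol{A}^*\}$. -}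

module Defs where

open import Level using (Level)
open import Data.Bool using (Bool; true; false; _∧_; _∨_; if_then_else_; T)
open import Data.Nat using (ℕ; zero; suc; _<ᵇ_; _≡ᵇ_)
open import Data.Fin using (Fin; toℕ; zero; suc)
open import Data.Maybe using (Maybe; just; nothing)
open import Data.List using (List; []; _∷_; _++_; length; map; concatMap; foldl; allFin; upTo)
open import Data.Bool.ListAction using (and)
open import Data.List.Membership.Propositional using (_∈_)
open import Data.List.Relation.Unary.Any using (Any)
open import Data.Vec using (Vec; []; _∷_; lookup; tabulate)
open import Data.Product using (Σ; ∃; _×_; _,_; proj₁)
open import Data.Unit using (⊤)
open import Relation.Nullary using (¬_)
open import Algebra.Bundles using (Semiring)

Word : ℕ → Set
Word k = List (Fin k)

wordsOfLength : (k : ℕ) → ℕ → List (Word k)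
wordsOfLength k zero    = [] ∷ []
wordsOfLength k (suc n) = concatMap (λ a → map (a ∷_) (wordsOfLength k n)) (allFin k)

-- lexicographic strict order (used on words of equal length)
lexLt : ∀ {k} → Word k → Word k → Bool
lexLt []       []       = false
lexLt (a ∷ as) (b ∷ bs) =
  if toℕ a <ᵇ toℕ b then true else (if toℕ a ≡ᵇ toℕ b then lexLt as bs else false)
lexLt _        _        = false

radLt : ∀ {k} → Word k → Word k → Bool
radLt u v = (length u <ᵇ length v) ∨ ((length u ≡ᵇ length v) ∧ lexLt u v)

count : ∀ {A : Set} → (A → Bool) → List A → ℕ
count p []       = zero
count p (x ∷ xs) = if p x then suc (count p xs) else count p xs

record DFA : Set where
  field
    k     : ℕ                    -- alphabet Fin k, totally ordered by the order of Fin
    nQ    : ℕ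
    q0    : Fin nQ
    δ     : Fin nQ → Fin k → Fin nQ
    final : Fin nQ → Bool

inL : (D : DFA) → Word (DFA.k D) → Bool
inL D w = DFA.final D (foldl (DFA.δ D) (DFA.q0 D) w)

-- abstract numeration system: an infinite regular language over a finite ordered alphabet
record ANS : Set where
  field
    dfa      : DFA
    infinite : (ws : List (Word (DFA.k dfa))) →
               ∃ λ w → T (inL dfa w) × ¬ (w ∈ ws)

alph : ANS → ℕ
alph S = DFA.k (ANS.dfa S)

InL : (S : ANS) → Word (alph S) → Bool
InL S = inL (ANS.dfa S)

val : (S : ANS) → Word (alph S) → ℕ
val S w = count (λ v → InL S v ∧ radLt v w)
                (concatMap (wordsOfLength (alph S)) (upTo (suc (length w))))

PrefixClosed : ANS → Set
PrefixClosed S = ∀ (u v : Word (alph S)) → T (InL S (u ++ v)) → T (InL S u)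

-- tuples in (A_1 ∪ {#}) × ... × (A_d ∪ {#});  nothing = #
Tup : ∀ {d} → Vec ANS d → Set
Tup []      = ⊤
Tup (S ∷ Ss) = Maybe (Fin (alph S)) × Tup Ss

notAllHash : ∀ {d} (Ss : Vec ANS d) → Tup Ss → Bool
notAllHash []       _              = false
notAllHash (S ∷ Ss) (just _ , t)   = true
notAllHash (S ∷ Ss) (nothing , t)  = notAllHash Ss t

Letter : ∀ {d} → Vec ANS d → Set
Letter Ss = Σ (Tup Ss) (λ t → T (notAllHash Ss t))

projT : ∀ {d} (Ss : Vec ANS d) (i : Fin d) → Tup Ss → Maybe (Fin (alph (lookup Ss i)))
projT (S ∷ Ss) zero    (x , _) = x
projT (S ∷ Ss) (suc i) (_ , t) = projT Ss i t

projW : ∀ {d} (Ss : Vec ANS d) (i : Fin d) → List (Letter Ss) → List (Maybe (Fin (alph (lookup Ss i))))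
projW Ss i u = map (λ a → projT Ss i (proj₁ a)) u

allJust : ∀ {A : Set} → List (Maybe A) → Bool
allJust []             = true
allJust (nothing ∷ xs) = false
allJust (just _ ∷ xs)  = allJust xs

wellPadded : ∀ {A : Set} → List (Maybe A) → Bool
wellPadded []             = true
wellPadded (nothing ∷ xs) = wellPadded xs
wellPadded (just _ ∷ xs)  = allJust xs

strip : ∀ {A : Set} → List (Maybe A) → List A
strip []             = []
strip (nothing ∷ xs) = strip xs
strip (just a ∷ xs)  = a ∷ strip xs

-- u ∈ bold-L, i.e. u = (w_1,...,w_d)^# with w_i ∈ L_i.
-- (Maximal padding length is automatic: no letter is (#,...,#).)
inBoldL : ∀ {d} (Ss : Vec ANS d) → List (Letter Ss) → Bool
inBoldL {d} Ss u =
  and (map (λ i → wellPadded (projW Ss i u) ∧ InL (lookup Ss i) (strip (projW Ss i u))) (allFin d))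

valB : ∀ {d} (Ss : Vec ANS d) → List (Letter Ss) → Vec ℕ d
valB Ss u = tabulate (λ i → val (lookup Ss i) (strip (projW Ss i u)))

record DFAO {c} {d} (Ss : Vec ANS d) (Δ : Set c) : Set c where
  field
    nQ : ℕ
    q0 : Fin nQ
    δ  : Fin nQ → Letter Ss → Fin nQ
    τ  : Fin nQ → Δ

outDFAO : ∀ {c d} {Ss : Vec ANS d} {Δ : Set c} → DFAO Ss Δ → List (Letter Ss) → Δ
outDFAO M u = DFAO.τ M (foldl (DFAO.δ M) (DFAO.q0 M) u)

module _ {c ℓ} (K : Semiring c ℓ) where
  open Semiring K

  -- f(n) = τ(δ(q0, rep(n))) for all n, written via u = rep(n), n = val(u)
  Automatic : ∀ {d} (Ss : Vec ANS d) → (Vec ℕ d → Carrier) → Set (c Level.⊔ ℓ)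
  Automatic Ss f = Σ (DFAO Ss Carrier) λ M →
    ∀ (u : List (Letter Ss)) → T (inBoldL Ss u) → f (valB Ss u) ≈ outDFAO M u

  -- g is (pointwise ≈) the kernel element f ∘ w
  IsKernelElem : ∀ {d} (Ss : Vec ANS d) → (Vec ℕ d → Carrier) → List (Letter Ss) →
                 (Vec ℕ d → Carrier) → Set ℓ
  IsKernelElem Ss f w g = ∀ (u : List (Letter Ss)) → T (inBoldL Ss u) →
    g (valB Ss u) ≈ (if inBoldL Ss (u ++ w) then f (valB Ss (u ++ w)) else 0#)

  FiniteKernel : ∀ {d} (Ss : Vec ANS d) → (Vec ℕ d → Carrier) → Set (c Level.⊔ ℓ)
  FiniteKernel Ss f = Σ (List (Vec _ _ → Carrier)) λ gs →
    ∀ (w : List (Letter Ss)) → Any (IsKernelElem Ss f w) gs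

-- If f is computed by an automaton, run it in parallel with one recognising 𝐋 (padding
-- and each Lᵢ); the product computes f extended by 0 off 𝐋, so (f ∘ w)(val u) is the
-- output of the state reached on u and then w. Hence f ∘ w only depends on the map
-- s ↦ δ(s, w) on the finite set of states, and there are finitely many such maps. To
-- turn this into a function of n one needs rep_𝐒: val is injective on 𝐋, and a word of
-- Lᵢ of value n is no longer than the n-th of a sequence of words of Lᵢ of increasing
-- lengths, so rep_𝐒 is found by bounded search.
--
-- Conversely, call suffixes w, w' equivalent if f⁰(uw) ≈ f⁰(uw') for every u ∈ 𝐋, where
-- f⁰ extends f by 0. Suffixes with the same kernel element are equivalent, and since the
-- Lᵢ are prefix-closed, equivalence survives prepending letters. By pigeonhole on
-- suffixes every word is equivalent to one of length less than the size m of the kernel.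
-- Reading p from left to right, an automaton keeps the map sending each short word r to
-- a short word equivalent to p r; its output is f⁰ of the one for r = [].

module Submission where

open import Defs
open import Level using (0ℓ) renaming (suc to lsuc; _⊔_ to _⊔ˡ_)
open import Data.Bool using (Bool; true; false; _∧_; if_then_else_; T)
open import Data.Bool.Properties using (T-∧; T-∨; T-≡; T-irrelevant)
open import Data.Nat
  using (ℕ; zero; suc; _+_; _∸_; _⊔_; _⊓_; _≤_; _<_; _≤′_; ≤′-refl; ≤′-step; z≤n; s≤s; _<ᵇ_; _≡ᵇ_; _≟_; _≤?_)
open import Data.Nat.Properties
open import Data.Fin using (Fin; toℕ; zero; suc)
open import Data.Fin.Properties using (toℕ-injective; toℕ≤pred[n]; pigeonhole) renaming (_≟_ to _≟ᶠ_)
open import Data.Maybe using (Maybe; just; nothing)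
open import Data.List
  using (List; []; _∷_; _++_; [_]; length; take; drop; map; concatMap; foldl; allFin; upTo; replicate; cartesianProduct)
open import Data.List.Properties
  using ( ++-identityʳ; ++-assoc; ∷-injectiveˡ; ∷-injectiveʳ; map-++; concatMap-++; foldl-++; foldl-map
        ; length-++; length-map; length-replicate; length-take; length-drop; take++drop≡id
        ; map-tabulate; tabulate-cong; upTo-∷ʳ)
  renaming (≡-dec to ≡-decᴸ)
open import Data.List.Relation.Unary.All.Properties using (all⁺; all⁻; tabulate⁺; tabulate⁻)
open import Data.List.Membership.Propositional using (_∈_; lose)
open import Data.List.Membership.Propositional.Properties
  using (∈-map⁺; ∈-++⁺ˡ; ∈-++⁺ʳ; ∈-allFin; ∈-concatMap⁺; ∈-cartesianProduct⁺)
import Data.List as List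
open import Data.List.Relation.Unary.Any using (here; there; any?; satisfied; index)
open import Data.List.Relation.Unary.Any.Properties using (lookup-index)
open import Data.Product using (∃; ∃₂; _×_; _,_; proj₁; proj₂)
open import Data.Unit using (⊤; tt)
import Data.Vec as Vec
open import Data.Vec using (Vec; lookup) renaming ([] to []ᵛ; _∷_ to _∷ᵛ_)
open import Data.Vec.Properties using (lookup∘tabulate) renaming (≡-dec to ≡-decᵛ)
open import Data.Sum using (_⊎_; inj₁; inj₂)
open import Data.Empty using (⊥-elim)
open import Function using (_∘_; id; flip; Equivalence)
open import Data.Bool.ListAction using (and)
open import Relation.Nullary using (¬_; Dec; yes; no; contradiction; _×-dec_)
open import Relation.Nullary.Decidable using (T?)
open import Relation.Binary.Definitions using (tri<; tri≈; tri>)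
open import Algebra.Bundles using (Semiring)
import Relation.Binary.Reasoning.Setoid as SetoidReasoning
open import Relation.Binary.PropositionalEquality
  using (_≡_; _≢_; refl; sym; trans; cong; cong₂; subst; module ≡-Reasoning)

open Equivalence using (to; from)

module _ {A : Set} where

  count-++ : ∀ (p : A → Bool) xs ys → count p (xs ++ ys) ≡ count p xs + count p ys
  count-++ p []       ys = refl
  count-++ p (x ∷ xs) ys with p x
  ... | true  = cong suc (count-++ p xs ys)
  ... | false = count-++ p xs ys

  count-++-≤ : ∀ (p : A → Bool) xs ys → count p xs ≤ count p (xs ++ ys)
  count-++-≤ p xs ys = subst (count p xs ≤_) (sym (count-++ p xs ys)) (m≤m+n _ _)

  count-mono : ∀ {p q : A → Bool} → (∀ x → T (p x) → T (q x)) → ∀ xs → count p xs ≤ count q xs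
  count-mono {p} {q} p⇒q []       = z≤n
  count-mono {p} {q} p⇒q (x ∷ xs) with p x | q x | p⇒q x
  ... | true  | true  | _   = s≤s (count-mono p⇒q xs)
  ... | true  | false | p⇒qₓ = ⊥-elim (p⇒qₓ _)
  ... | false | true  | _   = m≤n⇒m≤1+n (count-mono p⇒q xs)
  ... | false | false | _   = count-mono p⇒q xs

  count-< : ∀ {p q : A → Bool} → (∀ x → T (p x) → T (q x)) →
            ∀ {x xs} → x ∈ xs → T (q x) → ¬ T (p x) → count p xs < count q xs
  count-< {p} {q} p⇒q {xs = y ∷ xs} (here refl) qy ¬py with p y | q y
  ... | true  | _     = contradiction _ ¬py
  ... | false | false = ⊥-elim qy
  ... | false | true  = s≤s (count-mono p⇒q xs)
  count-< {p} {q} p⇒q {xs = y ∷ xs} (there x∈xs) qx ¬px with p y | q y | p⇒q y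
  ... | true  | true  | _    = s≤s (count-< p⇒q x∈xs qx ¬px)
  ... | true  | false | p⇒qʸ = ⊥-elim (p⇒qʸ _)
  ... | false | true  | _    = m≤n⇒m≤1+n (count-< p⇒q x∈xs qx ¬px)
  ... | false | false | _    = count-< p⇒q x∈xs qx ¬px

  count-pos : ∀ (p : A → Bool) {x xs} → x ∈ xs → T (p x) → 0 < count p xs
  count-pos p {xs = y ∷ xs} (here refl) py with p y
  ... | true  = s≤s z≤n
  count-pos p {xs = y ∷ xs} (there x∈xs) px with p y
  ... | true  = s≤s z≤n
  ... | false = count-pos p x∈xs px

∈-concatMap : ∀ {A B : Set} {f : A → List B} {x y xs} → y ∈ f x → x ∈ xs → y ∈ concatMap f xs
∈-concatMap {f = f} y∈fx x∈xs = ∈-concatMap⁺ f (lose x∈xs y∈fx)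

listsShorterThan : ∀ {A : Set} → List A → ℕ → List (List A)
listsShorterThan as zero    = []
listsShorterThan as (suc N) = [] ∷ concatMap (λ a → map (a ∷_) (listsShorterThan as N)) as

∈-listsShorterThan : ∀ {A : Set} {as : List A} → (∀ a → a ∈ as) →
                     ∀ (w : List A) {N} → length w < N → w ∈ listsShorterThan as N
∈-listsShorterThan ∈as []      {suc N} _         = here refl
∈-listsShorterThan ∈as (a ∷ w) {suc N} (s≤s w<N) =
  there (∈-concatMap (∈-map⁺ (a ∷_) (∈-listsShorterThan ∈as w w<N)) (∈as a))

-- The radix order

n<ᵇn≡false : ∀ n → (n <ᵇ n) ≡ false
n<ᵇn≡false zero    = refl
n<ᵇn≡false (suc n) = n<ᵇn≡false n

module _ {k : ℕ} where

  lexLt-∷⁻ : ∀ (a b : Fin k) as bs → T (lexLt (a ∷ as) (b ∷ bs)) →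
             toℕ a < toℕ b ⊎ (a ≡ b × T (lexLt as bs))
  lexLt-∷⁻ a b as bs lt with toℕ a <ᵇ toℕ b in a<ᵇb
  ... | true = inj₁ (<ᵇ⇒< _ _ (subst T (sym a<ᵇb) _))
  ... | false with toℕ a ≡ᵇ toℕ b in a≡ᵇb
  ...   | true = inj₂ (toℕ-injective (≡ᵇ⇒≡ _ _ (subst T (sym a≡ᵇb) _)) , lt)

  lexLt-∷⁺ : ∀ (a b : Fin k) as bs → toℕ a < toℕ b ⊎ (a ≡ b × T (lexLt as bs)) →
             T (lexLt (a ∷ as) (b ∷ bs))
  lexLt-∷⁺ a b  as bs (inj₁ a<b) rewrite to T-≡ (<⇒<ᵇ a<b) = _
  lexLt-∷⁺ a .a as bs (inj₂ (refl , lt))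
    rewrite n<ᵇn≡false (toℕ a) | to T-≡ (≡⇒≡ᵇ (toℕ a) (toℕ a) refl) = lt

  lexLt-irrefl : ∀ (v : Word k) → ¬ T (lexLt v v)
  lexLt-irrefl (a ∷ v) lt with lexLt-∷⁻ a a v v lt
  ... | inj₁ a<a        = n≮n _ a<a
  ... | inj₂ (_ , v<v)  = lexLt-irrefl v v<v

  lexLt-trans : ∀ (x y z : Word k) → T (lexLt x y) → T (lexLt y z) → T (lexLt x z)
  lexLt-trans (_ ∷ _) (_ ∷ _) []      _   ()
  lexLt-trans (a ∷ x) (b ∷ y) (c ∷ z) x<y y<z with lexLt-∷⁻ a b x y x<y | lexLt-∷⁻ b c y z y<z
  ... | inj₁ a<b         | inj₁ b<c         = lexLt-∷⁺ a c x z (inj₁ (<-trans a<b b<c))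
  ... | inj₁ a<b         | inj₂ (refl , _)  = lexLt-∷⁺ a c x z (inj₁ a<b)
  ... | inj₂ (refl , _)  | inj₁ b<c         = lexLt-∷⁺ a c x z (inj₁ b<c)
  ... | inj₂ (refl , x<y) | inj₂ (refl , y<z) =
    lexLt-∷⁺ a a x z (inj₂ (refl , lexLt-trans x y z x<y y<z))

  lexLt-connected : ∀ (x y : Word k) → length x ≡ length y → x ≢ y → T (lexLt x y) ⊎ T (lexLt y x)
  lexLt-connected []      []      _  x≢y = contradiction refl x≢y
  lexLt-connected (a ∷ x) (b ∷ y) eq x≢y with <-cmp (toℕ a) (toℕ b)
  ... | tri< a<b _ _ = inj₁ (lexLt-∷⁺ a b x y (inj₁ a<b))
  ... | tri> _ _ b<a = inj₂ (lexLt-∷⁺ b a y x (inj₁ b<a))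
  ... | tri≈ _ a≡b _ with refl ← toℕ-injective a≡b
    with lexLt-connected x y (suc-injective eq) (x≢y ∘ cong (a ∷_))
  ... | inj₁ x<y = inj₁ (lexLt-∷⁺ a a x y (inj₂ (refl , x<y)))
  ... | inj₂ y<x = inj₂ (lexLt-∷⁺ a a y x (inj₂ (refl , y<x)))

  radLt⁻ : ∀ (x y : Word k) → T (radLt x y) →
           length x < length y ⊎ (length x ≡ length y × T (lexLt x y))
  radLt⁻ x y lt with to T-∨ lt
  ... | inj₁ shorter = inj₁ (<ᵇ⇒< _ _ shorter)
  ... | inj₂ sameLengthLex with to (T-∧ {length x ≡ᵇ length y}) sameLengthLex
  ...   | sameLength , x<y = inj₂ (≡ᵇ⇒≡ _ _ sameLength , x<y)

  radLt⁺ : ∀ (x y : Word k) → length x < length y ⊎ (length x ≡ length y × T (lexLt x y)) →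
           T (radLt x y)
  radLt⁺ x y (inj₁ shorter)       = from T-∨ (inj₁ (<⇒<ᵇ shorter))
  radLt⁺ x y (inj₂ (same , x<y))  =
    from (T-∨ {length x <ᵇ length y}) (inj₂ (from T-∧ (≡⇒≡ᵇ _ _ same , x<y)))

  radLt-irrefl : ∀ (v : Word k) → ¬ T (radLt v v)
  radLt-irrefl v v<v with radLt⁻ v v v<v
  ... | inj₁ shorter  = n≮n _ shorter
  ... | inj₂ (_ , v<v) = lexLt-irrefl v v<v

  radLt-trans : ∀ (x y z : Word k) → T (radLt x y) → T (radLt y z) → T (radLt x z)
  radLt-trans x y z x<y y<z with radLt⁻ x y x<y | radLt⁻ y z y<z
  ... | inj₁ l₁       | inj₁ l₂        = radLt⁺ x z (inj₁ (<-trans l₁ l₂))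
  ... | inj₁ l₁       | inj₂ (e₂ , _)  = radLt⁺ x z (inj₁ (<-≤-trans l₁ (≤-reflexive e₂)))
  ... | inj₂ (e₁ , _) | inj₁ l₂        = radLt⁺ x z (inj₁ (≤-<-trans (≤-reflexive e₁) l₂))
  ... | inj₂ (e₁ , x<ʸy) | inj₂ (e₂ , y<ʸz) =
    radLt⁺ x z (inj₂ (trans e₁ e₂ , lexLt-trans x y z x<ʸy y<ʸz))

  radLt-connected : ∀ (x y : Word k) → x ≢ y → T (radLt x y) ⊎ T (radLt y x)
  radLt-connected x y x≢y with <-cmp (length x) (length y)
  ... | tri< shorter _ _ = inj₁ (radLt⁺ x y (inj₁ shorter))
  ... | tri> _ _ longer  = inj₂ (radLt⁺ y x (inj₁ longer))
  ... | tri≈ _ same _ with lexLt-connected x y same x≢y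
  ...   | inj₁ x<y = inj₁ (radLt⁺ x y (inj₂ (same , x<y)))
  ...   | inj₂ y<x = inj₂ (radLt⁺ y x (inj₂ (sym same , y<x)))

  radLt⇒length≤ : ∀ (x y : Word k) → T (radLt x y) → length x ≤ length y
  radLt⇒length≤ x y x<y with radLt⁻ x y x<y
  ... | inj₁ shorter   = <⇒≤ shorter
  ... | inj₂ (same , _) = ≤-reflexive same

-- Values in one dimension

wordsUpTo : (k N : ℕ) → List (Word k)
wordsUpTo k N = concatMap (wordsOfLength k) (upTo N)

module _ {k : ℕ} where

  ∈-wordsOfLength : (v : Word k) → v ∈ wordsOfLength k (length v)
  ∈-wordsOfLength []      = here refl
  ∈-wordsOfLength (a ∷ v) = ∈-concatMap (∈-map⁺ (a ∷_) (∈-wordsOfLength v)) (∈-allFin a)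

  wordsUpTo-suc : ∀ N → wordsUpTo k (suc N) ≡ wordsUpTo k N ++ wordsOfLength k N
  wordsUpTo-suc N = begin
    concatMap (wordsOfLength k) (upTo (suc N))
      ≡⟨ cong (concatMap (wordsOfLength k)) (sym (upTo-∷ʳ N)) ⟩
    concatMap (wordsOfLength k) (upTo N ++ [ N ])
      ≡⟨ concatMap-++ (wordsOfLength k) (upTo N) [ N ] ⟩
    wordsUpTo k N ++ (wordsOfLength k N ++ [])
      ≡⟨ cong (wordsUpTo k N ++_) (++-identityʳ (wordsOfLength k N)) ⟩
    wordsUpTo k N ++ wordsOfLength k N ∎
    where open ≡-Reasoning

  wordsUpTo-extends : ∀ {N N'} → N ≤′ N' → ∃ λ ys → wordsUpTo k N' ≡ wordsUpTo k N ++ ys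
  wordsUpTo-extends ≤′-refl = [] , sym (++-identityʳ _)
  wordsUpTo-extends {N} (≤′-step {N'} N≤′N') with ys , eq ← wordsUpTo-extends N≤′N' =
    ys ++ wordsOfLength k N' ,
    trans (wordsUpTo-suc N') (trans (cong (_++ wordsOfLength k N') eq) (++-assoc (wordsUpTo k N) ys _))

  ∈-wordsUpTo : ∀ (v : Word k) {N} → length v < N → v ∈ wordsUpTo k N
  ∈-wordsUpTo v v<N with ys , eq ← wordsUpTo-extends (≤⇒≤′ v<N) =
    subst (v ∈_) (sym eq) (∈-++⁺ˡ (subst (v ∈_) (sym (wordsUpTo-suc (length v)))
                                         (∈-++⁺ʳ _ (∈-wordsOfLength v))))

  count-wordsUpTo-mono : ∀ (p : Word k → Bool) {N N'} → N ≤ N' →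
                         count p (wordsUpTo k N) ≤ count p (wordsUpTo k N')
  count-wordsUpTo-mono p {N} N≤N' with ys , eq ← wordsUpTo-extends (≤⇒≤′ N≤N') =
    subst (λ ws → count p (wordsUpTo k N) ≤ count p ws) (sym eq) (count-++-≤ p (wordsUpTo k N) ys)

module _ (S : ANS) where

  private
    k = alph S

  belowIn : Word k → Word k → Bool
  belowIn u v = InL S v ∧ radLt v u

  val-< : ∀ {v v' : Word k} → T (InL S v) → T (radLt v v') → val S v < val S v'
  val-< {v} {v'} v∈L v<v' = begin-strict
    count (belowIn v)  (wordsUpTo k (suc (length v)))
      <⟨ count-< below-v⇒below-v' v∈ (from T-∧ (v∈L , v<v')) v≮v ⟩
    count (belowIn v') (wordsUpTo k (suc (length v)))
      ≤⟨ count-wordsUpTo-mono (belowIn v') (s≤s (radLt⇒length≤ v v' v<v')) ⟩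
    count (belowIn v') (wordsUpTo k (suc (length v'))) ∎
    where
    open ≤-Reasoning
    below-v⇒below-v' : ∀ x → T (belowIn v x) → T (belowIn v' x)
    below-v⇒below-v' x x-below with x∈L , x<v ← to T-∧ x-below =
      from T-∧ (x∈L , radLt-trans x v v' x<v v<v')
    v∈ : v ∈ wordsUpTo k (suc (length v))
    v∈ = ∈-wordsUpTo v ≤-refl
    v≮v : ¬ T (belowIn v v)
    v≮v = radLt-irrefl v ∘ proj₂ ∘ to T-∧

  val-injective : ∀ {v v' : Word k} → T (InL S v) → T (InL S v') → val S v ≡ val S v' → v ≡ v'
  val-injective {v} {v'} v∈L v'∈L eq with ≡-decᴸ _≟ᶠ_ v v'
  ... | yes v≡v' = v≡v'
  ... | no v≢v' with radLt-connected v v' v≢v'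
  ...   | inj₁ v<v' = contradiction eq (<⇒≢ (val-< {v} {v'} v∈L v<v'))
  ...   | inj₂ v'<v = contradiction (sym eq) (<⇒≢ (val-< {v'} {v} v'∈L v'<v))

  wordOfLengthAtLeast : ℕ → Word k
  wordOfLengthAtLeast N = proj₁ (ANS.infinite S (wordsUpTo k N))

  wordOfLengthAtLeast-∈ : ∀ N → T (InL S (wordOfLengthAtLeast N))
  wordOfLengthAtLeast-∈ N = proj₁ (proj₂ (ANS.infinite S (wordsUpTo k N)))

  wordOfLengthAtLeast-length : ∀ N → N ≤ length (wordOfLengthAtLeast N)
  wordOfLengthAtLeast-length N with N ≤? length (wordOfLengthAtLeast N)
  ... | yes N≤ = N≤
  ... | no  N≰ = contradiction (∈-wordsUpTo _ {N} (≰⇒> N≰))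
                               (proj₂ (proj₂ (ANS.infinite S (wordsUpTo k N))))

  witness : ℕ → Word k
  witness zero    = wordOfLengthAtLeast 0
  witness (suc j) = wordOfLengthAtLeast (suc (length (witness j)))

  witness-∈ : ∀ j → T (InL S (witness j))
  witness-∈ zero    = wordOfLengthAtLeast-∈ 0
  witness-∈ (suc j) = wordOfLengthAtLeast-∈ (suc (length (witness j)))

  length-witness-< : ∀ j → length (witness j) < length (witness (suc j))
  length-witness-< j = wordOfLengthAtLeast-length (suc (length (witness j)))

  private
    count-witness-step : ∀ u j → length (witness j) < length u →
                         count (belowIn u) (wordsUpTo k (length (witness j))) <
                         count (belowIn u) (wordsUpTo k (suc (length (witness j))))
    count-witness-step u j wⱼ<u = begin-strict
      count P (wordsUpTo k ℓ)
        <⟨ m<m+n _ (count-pos P (∈-wordsOfLength (witness j)) wⱼ-below) ⟩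
      count P (wordsUpTo k ℓ) + count P (wordsOfLength k ℓ)
        ≡⟨ sym (count-++ P (wordsUpTo k ℓ) _) ⟩
      count P (wordsUpTo k ℓ ++ wordsOfLength k ℓ)
        ≡⟨ cong (count P) (sym (wordsUpTo-suc ℓ)) ⟩
      count P (wordsUpTo k (suc ℓ))
        ∎
      where
      open ≤-Reasoning
      P = belowIn u
      ℓ = length (witness j)
      wⱼ-below : T (belowIn u (witness j))
      wⱼ-below = from T-∧ (witness-∈ j , radLt⁺ (witness j) u (inj₁ wⱼ<u))

    witnesses-counted : ∀ u j → length (witness j) < length u →
                        j < count (belowIn u) (wordsUpTo k (suc (length (witness j))))
    witnesses-counted u zero    w₀<u = <-≤-trans (s≤s z≤n) (count-witness-step u 0 w₀<u)
    witnesses-counted u (suc i) wᵢ₊₁<u =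
      ≤-<-trans (<-≤-trans (witnesses-counted u i (<-trans (length-witness-< i) wᵢ₊₁<u))
                           (count-wordsUpTo-mono (belowIn u) (length-witness-< i)))
                (count-witness-step u (suc i) wᵢ₊₁<u)

  -- If u were longer, the n + 1 words witness 0, …, witness n of L (n = val S u) would all precede u.
  length≤length-witness-val : ∀ (u : Word k) → length u ≤ length (witness (val S u))
  length≤length-witness-val u with length u ≤? length (witness (val S u))
  ... | yes u≤w = u≤w
  ... | no  u≰w = contradiction
    (<-≤-trans (witnesses-counted u (val S u) (≰⇒> u≰w))
               (count-wordsUpTo-mono (belowIn u) (m≤n⇒m≤1+n (≰⇒> u≰w))))
    (<-irrefl refl)

-- Padded words

module _ {A : Set} where

  padLeft : ℕ → List A → List (Maybe A)
  padLeft m w = replicate m nothing ++ map just w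

  length-padLeft : ∀ m w → length (padLeft m w) ≡ m + length w
  length-padLeft m w = trans (length-++ (replicate m nothing))
                             (cong₂ _+_ (length-replicate m) (length-map just w))

  allJust⇒≡map-just : ∀ (xs : List (Maybe A)) → T (allJust xs) → xs ≡ map just (strip xs)
  allJust⇒≡map-just []            _  = refl
  allJust⇒≡map-just (just x ∷ xs) aj = cong (just x ∷_) (allJust⇒≡map-just xs aj)

  wellPadded⇒padLeft : ∀ (xs : List (Maybe A)) → T (wellPadded xs) → ∃ λ m → xs ≡ padLeft m (strip xs)
  wellPadded⇒padLeft []             _  = 0 , refl
  wellPadded⇒padLeft (nothing ∷ xs) wp with m , eq ← wellPadded⇒padLeft xs wp = suc m , cong (nothing ∷_) eq
  wellPadded⇒padLeft (just x ∷ xs)  wp = 0 , cong (just x ∷_) (allJust⇒≡map-just xs wp)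

  wellPadded-injective : ∀ {xs ys : List (Maybe A)} → T (wellPadded xs) → T (wellPadded ys) →
                         length xs ≡ length ys → strip xs ≡ strip ys → xs ≡ ys
  wellPadded-injective {xs} {ys} wp-xs wp-ys |xs|≡|ys| sx≡sy
    with m , xs≡ ← wellPadded⇒padLeft xs wp-xs | m' , ys≡ ← wellPadded⇒padLeft ys wp-ys = begin
      xs                    ≡⟨ xs≡ ⟩
      padLeft m  (strip xs) ≡⟨ cong₂ padLeft m≡m' sx≡sy ⟩
      padLeft m' (strip ys) ≡⟨ sym ys≡ ⟩
      ys                    ∎
    where
    open ≡-Reasoning
    m≡m' : m ≡ m'
    m≡m' = +-cancelʳ-≡ (length (strip xs)) m m' (begin
      m  + length (strip xs)      ≡⟨ sym (length-padLeft m (strip xs)) ⟩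
      length (padLeft m (strip xs)) ≡⟨ cong length (sym xs≡) ⟩
      length xs                   ≡⟨ |xs|≡|ys| ⟩
      length ys                   ≡⟨ cong length ys≡ ⟩
      length (padLeft m' (strip ys)) ≡⟨ length-padLeft m' (strip ys) ⟩
      m' + length (strip ys)      ≡⟨ cong (m' +_) (cong length (sym sx≡sy)) ⟩
      m' + length (strip xs)      ∎)

  length-strip-≤ : ∀ (xs : List (Maybe A)) → length (strip xs) ≤ length xs
  length-strip-≤ []             = z≤n
  length-strip-≤ (nothing ∷ xs) = m≤n⇒m≤1+n (length-strip-≤ xs)
  length-strip-≤ (just _ ∷ xs)  = s≤s (length-strip-≤ xs)

  length-strip-just-∷ : ∀ x (xs : List (Maybe A)) → T (wellPadded (just x ∷ xs)) →
                        length (strip (just x ∷ xs)) ≡ length (just x ∷ xs)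
  length-strip-just-∷ x xs aj = cong suc (sym (trans (cong length (allJust⇒≡map-just xs aj))
                                                     (length-map just (strip xs))))

  allJust-++ˡ : ∀ (xs ys : List (Maybe A)) → T (allJust (xs ++ ys)) → T (allJust xs)
  allJust-++ˡ []            ys _  = _
  allJust-++ˡ (just _ ∷ xs) ys aj = allJust-++ˡ xs ys aj

  wellPadded-++ˡ : ∀ (xs ys : List (Maybe A)) → T (wellPadded (xs ++ ys)) → T (wellPadded xs)
  wellPadded-++ˡ []             ys _  = _
  wellPadded-++ˡ (nothing ∷ xs) ys wp = wellPadded-++ˡ xs ys wp
  wellPadded-++ˡ (just _ ∷ xs)  ys wp = allJust-++ˡ xs ys wp

  strip-++ : ∀ (xs ys : List (Maybe A)) → strip (xs ++ ys) ≡ strip xs ++ strip ys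
  strip-++ []             ys = refl
  strip-++ (nothing ∷ xs) ys = strip-++ xs ys
  strip-++ (just x ∷ xs)  ys = cong (x ∷_) (strip-++ xs ys)

-- Words over the product alphabet

symbols : (S : ANS) → List (Maybe (Fin (alph S)))
symbols S = nothing ∷ map just (allFin (alph S))

∈-symbols : ∀ S x → x ∈ symbols S
∈-symbols S nothing  = here refl
∈-symbols S (just x) = there (∈-map⁺ just (∈-allFin x))

tuples : ∀ {d} (Ts : Vec ANS d) → List (Tup Ts)
tuples []ᵛ       = [ tt ]
tuples (S ∷ᵛ Ts) = cartesianProduct (symbols S) (tuples Ts)

∈-tuples : ∀ {d} (Ts : Vec ANS d) (t : Tup Ts) → t ∈ tuples Ts
∈-tuples []ᵛ       tt      = here refl
∈-tuples (S ∷ᵛ Ts) (x , t) = ∈-cartesianProduct⁺ (∈-symbols S x) (∈-tuples Ts t)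

tuple-ext : ∀ {d} (Ts : Vec ANS d) {t t' : Tup Ts} → (∀ i → projT Ts i t ≡ projT Ts i t') → t ≡ t'
tuple-ext []ᵛ       _       = refl
tuple-ext (S ∷ᵛ Ts) same-projT = cong₂ _,_ (same-projT zero) (tuple-ext Ts (same-projT ∘ suc))

justCoordinate : ∀ {d} (Ts : Vec ANS d) (t : Tup Ts) → T (notAllHash Ts t) →
                 ∃₂ λ i x → projT Ts i t ≡ just x
justCoordinate (S ∷ᵛ Ts) (just x , t)  _ = zero , x , refl
justCoordinate (S ∷ᵛ Ts) (nothing , t) t≢# with i , x , eq ← justCoordinate Ts t t≢# = suc i , x , eq

lengthBound : ∀ {d} (Ts : Vec ANS d) → Vec ℕ d → ℕ
lengthBound []ᵛ       []ᵛ       = 0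
lengthBound (S ∷ᵛ Ts) (n ∷ᵛ ns) = length (witness S n) ⊔ lengthBound Ts ns

length-witness≤lengthBound : ∀ {d} (Ts : Vec ANS d) ns i →
                             length (witness (lookup Ts i) (lookup ns i)) ≤ lengthBound Ts ns
length-witness≤lengthBound (S ∷ᵛ Ts) (n ∷ᵛ ns) zero    = m≤m⊔n _ _
length-witness≤lengthBound (S ∷ᵛ Ts) (n ∷ᵛ ns) (suc i) =
  ≤-trans (length-witness≤lengthBound Ts ns i) (m≤n⊔m _ _)

module _ {d : ℕ} (Ss : Vec ANS d) where

  private
    Wd = List (Letter Ss)

  toLetter : Tup Ss → List (Letter Ss)
  toLetter t with T? (notAllHash Ss t)
  ... | yes t≢# = [ t , t≢# ]
  ... | no  _   = []

  letters : List (Letter Ss)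
  letters = concatMap toLetter (tuples Ss)

  ∈-letters : ∀ a → a ∈ letters
  ∈-letters (t , t≢#) = ∈-concatMap (∈-toLetter t t≢#) (∈-tuples Ss t)
    where
    ∈-toLetter : ∀ t (t≢# : T (notAllHash Ss t)) → (t , t≢#) ∈ toLetter t
    ∈-toLetter t t≢# with T? (notAllHash Ss t)
    ... | yes t≢#' = here (cong (t ,_) (T-irrelevant t≢# t≢#'))
    ... | no  t≡#  = contradiction t≢# t≡#

  projW-injective : ∀ {u u' : Wd} → length u ≡ length u' → (∀ i → projW Ss i u ≡ projW Ss i u') → u ≡ u'
  projW-injective {[]}    {[]}     _ _ = refl
  projW-injective {a ∷ u} {a' ∷ u'} |u|≡|u'| same-projW = cong₂ _∷_
    (letter-≡ (tuple-ext Ss (∷-injectiveˡ ∘ same-projW)))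
    (projW-injective (suc-injective |u|≡|u'|) (∷-injectiveʳ ∘ same-projW))
    where
    letter-≡ : proj₁ a ≡ proj₁ a' → a ≡ a'
    letter-≡ refl = cong (proj₁ a ,_) (T-irrelevant (proj₂ a) (proj₂ a'))

  component : (i : Fin d) → Wd → Word (alph (lookup Ss i))
  component i u = strip (projW Ss i u)

  componentOK : Fin d → Wd → Bool
  componentOK i u = wellPadded (projW Ss i u) ∧ InL (lookup Ss i) (component i u)

  inBoldL⇒componentOK : ∀ u → T (inBoldL Ss u) → ∀ i → T (componentOK i u)
  inBoldL⇒componentOK u u∈L = tabulate⁻ (all⁺ (flip componentOK u) (allFin d) u∈L)

  inBoldL⇒wellPadded : ∀ u → T (inBoldL Ss u) → ∀ i → T (wellPadded (projW Ss i u))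
  inBoldL⇒wellPadded u u∈L i = proj₁ (to T-∧ (inBoldL⇒componentOK u u∈L i))

  inBoldL⇒component∈L : ∀ u → T (inBoldL Ss u) → ∀ i → T (InL (lookup Ss i) (component i u))
  inBoldL⇒component∈L u u∈L i =
    proj₂ (to (T-∧ {wellPadded (projW Ss i u)}) (inBoldL⇒componentOK u u∈L i))

  inBoldL-prefix : (∀ i → PrefixClosed (lookup Ss i)) → ∀ u v → T (inBoldL Ss (u ++ v)) → T (inBoldL Ss u)
  inBoldL-prefix closed u v uv∈L = all⁻ (flip componentOK u) (tabulate⁺ λ i → from T-∧
    ( wellPadded-++ˡ (projW Ss i u) (projW Ss i v)
        (subst (T ∘ wellPadded) (projW-++ i) (inBoldL⇒wellPadded (u ++ v) uv∈L i))
    , closed i (component i u) (component i v)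
        (subst (T ∘ InL (lookup Ss i)) (component-++ i) (inBoldL⇒component∈L (u ++ v) uv∈L i))))
    where
    projW-++ : ∀ i → projW Ss i (u ++ v) ≡ projW Ss i u ++ projW Ss i v
    projW-++ i = map-++ (λ a → projT Ss i (proj₁ a)) u v
    component-++ : ∀ i → component i (u ++ v) ≡ component i u ++ component i v
    component-++ i = trans (cong strip (projW-++ i)) (strip-++ (projW Ss i u) (projW Ss i v))

  lookup-valB : ∀ u i → lookup (valB Ss u) i ≡ val (lookup Ss i) (component i u)
  lookup-valB u i = lookup∘tabulate _ i

  length-full-component : ∀ a u → T (inBoldL Ss (a ∷ u)) →
                          ∃ λ i → length (component i (a ∷ u)) ≡ length (a ∷ u)
  length-full-component a u a∷u∈L with i , x , aᵢ≡x ← justCoordinate Ss (proj₁ a) (proj₂ a) = i , (begin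
    length (strip (projT Ss i (proj₁ a) ∷ projW Ss i u))
      ≡⟨ cong (λ y → length (strip (y ∷ projW Ss i u))) aᵢ≡x ⟩
    length (strip (just x ∷ projW Ss i u))
      ≡⟨ length-strip-just-∷ x (projW Ss i u) wp ⟩
    suc (length (projW Ss i u))
      ≡⟨ cong suc (length-map _ u) ⟩
    suc (length u)
      ∎)
    where
    open ≡-Reasoning
    wp : T (wellPadded (just x ∷ projW Ss i u))
    wp = subst (λ y → T (wellPadded (y ∷ projW Ss i u))) aᵢ≡x (inBoldL⇒wellPadded (a ∷ u) a∷u∈L i)

  length-≤-of-components : ∀ {u u' : Wd} → T (inBoldL Ss u) → (∀ i → component i u ≡ component i u') →
                           length u ≤ length u'
  length-≤-of-components {[]}    _     _    = z≤n
  length-≤-of-components {a ∷ u} {u'} a∷u∈L same with i , full ← length-full-component a u a∷u∈L = begin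
    length (a ∷ u)           ≡⟨ sym full ⟩
    length (component i (a ∷ u)) ≡⟨ cong length (same i) ⟩
    length (component i u')  ≤⟨ length-strip-≤ (projW Ss i u') ⟩
    length (projW Ss i u')   ≡⟨ length-map _ u' ⟩
    length u'                ∎
    where open ≤-Reasoning

  valB-injective : ∀ {u u' : Wd} → T (inBoldL Ss u) → T (inBoldL Ss u') → valB Ss u ≡ valB Ss u' → u ≡ u'
  valB-injective {u} {u'} u∈L u'∈L eq = projW-injective |u|≡|u'| λ i →
    wellPadded-injective (inBoldL⇒wellPadded u u∈L i) (inBoldL⇒wellPadded u' u'∈L i)
      (trans (length-map _ u) (trans |u|≡|u'| (sym (length-map _ u')))) (same i)
    where
    same : ∀ i → component i u ≡ component i u'
    same i = val-injective (lookup Ss i) {component i u} {component i u'} 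
      (inBoldL⇒component∈L u u∈L i) (inBoldL⇒component∈L u' u'∈L i)
      (trans (sym (lookup-valB u i)) (trans (cong (λ n → lookup n i) eq) (lookup-valB u' i)))
    |u|≡|u'| : length u ≡ length u'
    |u|≡|u'| = ≤-antisym (length-≤-of-components {u} {u'} u∈L same)
                         (length-≤-of-components {u'} {u} u'∈L (sym ∘ same))

  length≤lengthBound : ∀ u → T (inBoldL Ss u) → length u ≤ lengthBound Ss (valB Ss u)
  length≤lengthBound []      _      = z≤n
  length≤lengthBound (a ∷ u) a∷u∈L with i , full ← length-full-component a u a∷u∈L = begin
    length (a ∷ u)
      ≡⟨ sym full ⟩
    length (component i (a ∷ u))
      ≤⟨ length≤length-witness-val Sᵢ (component i (a ∷ u)) ⟩
    length (witness Sᵢ (val Sᵢ (component i (a ∷ u))))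
      ≡⟨ cong (length ∘ witness Sᵢ) (sym (lookup-valB (a ∷ u) i)) ⟩
    length (witness Sᵢ (lookup (valB Ss (a ∷ u)) i))
      ≤⟨ length-witness≤lengthBound Ss (valB Ss (a ∷ u)) i ⟩
    lengthBound Ss (valB Ss (a ∷ u))
      ∎
    where
    open ≤-Reasoning
    Sᵢ = lookup Ss i

  IsRep : Vec ℕ d → Wd → Set
  IsRep n u = T (inBoldL Ss u) × valB Ss u ≡ n

  isRep? : ∀ n u → Dec (IsRep n u)
  isRep? n u = T? (inBoldL Ss u) ×-dec ≡-decᵛ _≟_ (valB Ss u) n

  -- rep_𝐒 by exhaustive search, justified by length≤lengthBound; the default [] is junk.
  repB : Vec ℕ d → Wd
  repB n with any? (isRep? n) (listsShorterThan letters (suc (lengthBound Ss n)))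
  ... | yes found = proj₁ (satisfied found)
  ... | no  _     = []

  repB-valB : ∀ u → T (inBoldL Ss u) → repB (valB Ss u) ≡ u
  repB-valB u u∈L
    with any? (isRep? (valB Ss u)) (listsShorterThan letters (suc (lengthBound Ss (valB Ss u))))
  ... | yes found = let _ , u'∈L , eq = satisfied found in valB-injective u'∈L u∈L eq
  ... | no  none  = contradiction
    (lose (∈-listsShorterThan ∈-letters u (s≤s (length≤lengthBound u u∈L))) (u∈L , refl)) none

-- Automata with output over an enumerated set of states

record FiniteDFAO {c} (A : Set) (C : Set c) : Set (lsuc 0ℓ ⊔ˡ c) where
  field
    State    : Set
    states   : List State
    ∈-states : ∀ s → s ∈ states
    start    : State
    step     : State → A → State
    out      : State → C

  run : State → List A → State
  run = foldl step

  output : List A → C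
  output u = out (run start u)

open FiniteDFAO using (State; states; ∈-states; start; step; out; run; output)

fromDFA : (D : DFA) → FiniteDFAO (Fin (DFA.k D)) Bool
fromDFA D = record
  { State = Fin (DFA.nQ D) ; states = allFin _ ; ∈-states = ∈-allFin
  ; start = DFA.q0 D ; step = DFA.δ D ; out = DFA.final D }

module _ {A : Set} where

  accepting : FiniteDFAO A Bool
  accepting = record
    { State = ⊤ ; states = [ tt ] ; ∈-states = λ _ → here refl
    ; start = tt ; step = λ _ _ → tt ; out = λ _ → true }

  comap : ∀ {c} {B : Set} {C : Set c} → (B → A) → FiniteDFAO A C → FiniteDFAO B C
  comap g M = record
    { State = State M ; states = states M ; ∈-states = ∈-states M
    ; start = start M ; step = λ s b → step M s (g b) ; out = out M }

  output-comap : ∀ {c} {B : Set} {C : Set c} (g : B → A) (M : FiniteDFAO A C) u →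
                 output (comap g M) u ≡ output M (map g u)
  output-comap g M u = cong (out M) (sym (foldl-map (step M) g (start M) u))

  zipWith : ∀ {c d e} {C : Set c} {D : Set d} {E : Set e} →
            (C → D → E) → FiniteDFAO A C → FiniteDFAO A D → FiniteDFAO A E
  zipWith g M N = record
    { State = State M × State N
    ; states = cartesianProduct (states M) (states N)
    ; ∈-states = λ (s , t) → ∈-cartesianProduct⁺ (∈-states M s) (∈-states N t)
    ; start = start M , start N
    ; step = λ (s , t) a → step M s a , step N t a
    ; out = λ (s , t) → g (out M s) (out N t) }

  output-zipWith : ∀ {c d e} {C : Set c} {D : Set d} {E : Set e}
                   (g : C → D → E) (M : FiniteDFAO A C) (N : FiniteDFAO A D) u →
                   output (zipWith g M N) u ≡ g (output M u) (output N u)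
  output-zipWith g M N u = cong (λ (s , t) → g (out M s) (out N t)) (run-zipWith (start M) (start N) u)
    where
    run-zipWith : ∀ s t u → run (zipWith g M N) (s , t) u ≡ (run M s u , run N t u)
    run-zipWith s t []      = refl
    run-zipWith s t (a ∷ u) = run-zipWith (step M s a) (step N t a) u

  allOf : ∀ n → (Fin n → FiniteDFAO A Bool) → FiniteDFAO A Bool
  allOf zero    M = accepting
  allOf (suc n) M = zipWith _∧_ (M zero) (allOf n (M ∘ suc))

  output-allOf : ∀ n (M : Fin n → FiniteDFAO A Bool) u →
                 output (allOf n M) u ≡ and (List.tabulate (λ i → output (M i) u))
  output-allOf zero    M u = refl
  output-allOf (suc n) M u = trans (output-zipWith _∧_ (M zero) (allOf n (M ∘ suc)) u)
                                   (cong (output (M zero) u ∧_) (output-allOf n (M ∘ suc) u))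

  data Phase : Set where
    leading reading trailing : Phase

  padded : FiniteDFAO A Bool → FiniteDFAO (Maybe A) Bool
  padded M = record
    { State = Phase × State M
    ; states = cartesianProduct (leading ∷ reading ∷ trailing ∷ []) (states M)
    ; ∈-states = λ (p , s) → ∈-cartesianProduct⁺ (∈-phases p) (∈-states M s)
    ; start = leading , start M
    ; step = paddedStep
    ; out = λ where (trailing , _) → false ; (_ , s) → out M s }
    where
    ∈-phases : ∀ p → p ∈ leading ∷ reading ∷ trailing ∷ []
    ∈-phases leading  = here refl
    ∈-phases reading  = there (here refl)
    ∈-phases trailing = there (there (here refl))
    paddedStep : Phase × State M → Maybe A → Phase × State M
    paddedStep (leading  , s) nothing  = leading , s
    paddedStep (leading  , s) (just a) = reading , step M s a
    paddedStep (reading  , s) nothing  = trailing , s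
    paddedStep (reading  , s) (just a) = reading , step M s a
    paddedStep (trailing , s) _        = trailing , s

  output-padded : ∀ (M : FiniteDFAO A Bool) xs →
                  output (padded M) xs ≡ wellPadded xs ∧ output M (strip xs)
  output-padded M = from-leading (start M)
    where
    P = padded M
    from-trailing : ∀ s xs → out P (run P (trailing , s) xs) ≡ false
    from-trailing s []       = refl
    from-trailing s (_ ∷ xs) = from-trailing s xs
    from-reading : ∀ s xs → out P (run P (reading , s) xs) ≡ allJust xs ∧ out M (run M s (strip xs))
    from-reading s []             = refl
    from-reading s (nothing ∷ xs) = from-trailing s xs
    from-reading s (just a ∷ xs)  = from-reading (step M s a) xs
    from-leading : ∀ s xs → out P (run P (leading , s) xs) ≡ wellPadded xs ∧ out M (run M s (strip xs))
    from-leading s []             = refl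
    from-leading s (nothing ∷ xs) = from-leading s xs
    from-leading s (just a ∷ xs)  = from-reading (step M s a) xs

module _ {c} {d} {Ss : Vec ANS d} {C : Set c} where

  fromDFAO : DFAO Ss C → FiniteDFAO (Letter Ss) C
  fromDFAO M = record
    { State = Fin (DFAO.nQ M) ; states = allFin _ ; ∈-states = ∈-allFin
    ; start = DFAO.q0 M ; step = DFAO.δ M ; out = DFAO.τ M }

  encode : (M : FiniteDFAO (Letter Ss) C) → State M → Fin (length (states M))
  encode M s = index (∈-states M s)

  decode : (M : FiniteDFAO (Letter Ss) C) → Fin (length (states M)) → State M
  decode M = List.lookup (states M)

  decode-encode : ∀ (M : FiniteDFAO (Letter Ss) C) s → decode M (encode M s) ≡ s
  decode-encode M s = sym (lookup-index (∈-states M s))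

  toDFAO : FiniteDFAO (Letter Ss) C → DFAO Ss C
  toDFAO M = record
    { nQ = length (states M)
    ; q0 = encode M (start M)
    ; δ  = λ i a → encode M (step M (decode M i) a)
    ; τ  = out M ∘ decode M }

  outDFAO-toDFAO : ∀ (M : FiniteDFAO (Letter Ss) C) u → outDFAO (toDFAO M) u ≡ output M u
  outDFAO-toDFAO M u = trans (cong (out M ∘ decode M) (run-encoded (start M) u))
                             (cong (out M) (decode-encode M (run M (start M) u)))
    where
    run-encoded : ∀ s u → foldl (DFAO.δ (toDFAO M)) (encode M s) u ≡ encode M (run M s u)
    run-encoded s []      = refl
    run-encoded s (a ∷ u) rewrite decode-encode M s = run-encoded (step M s a) u

componentDFAO : ∀ {d} (Ss : Vec ANS d) (i : Fin d) → FiniteDFAO (Letter Ss) Bool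
componentDFAO Ss i = comap (λ a → projT Ss i (proj₁ a)) (padded (fromDFA (ANS.dfa (lookup Ss i))))

output-componentDFAO : ∀ {d} (Ss : Vec ANS d) i u → output (componentDFAO Ss i) u ≡ componentOK Ss i u
output-componentDFAO Ss i u =
  trans (output-comap _ (padded (fromDFA (ANS.dfa (lookup Ss i)))) u)
        (output-padded (fromDFA (ANS.dfa (lookup Ss i))) (projW Ss i u))

boldL-DFAO : ∀ {d} (Ss : Vec ANS d) → FiniteDFAO (Letter Ss) Bool
boldL-DFAO {d} Ss = allOf d (componentDFAO Ss)

output-boldL-DFAO : ∀ {d} (Ss : Vec ANS d) u → output (boldL-DFAO Ss) u ≡ inBoldL Ss u
output-boldL-DFAO {d} Ss u = begin
  output (boldL-DFAO Ss) u
    ≡⟨ output-allOf d (componentDFAO Ss) u ⟩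
  and (List.tabulate (λ i → output (componentDFAO Ss i) u))
    ≡⟨ cong and (tabulate-cong λ i → output-componentDFAO Ss i u) ⟩
  and (List.tabulate (λ i → componentOK Ss i u))
    ≡⟨ cong and (sym (map-tabulate id (λ i → componentOK Ss i u))) ⟩
  inBoldL Ss u
    ∎
  where open ≡-Reasoning

vecsOver : ∀ {X : Set} → List X → (n : ℕ) → List (Vec X n)
vecsOver xs zero    = [ []ᵛ ]
vecsOver xs (suc n) = concatMap (λ x → map (x ∷ᵛ_) (vecsOver xs n)) xs

∈-vecsOver : ∀ {X : Set} {xs : List X} → (∀ x → x ∈ xs) → ∀ {n} (v : Vec X n) → v ∈ vecsOver xs n
∈-vecsOver ∈xs []ᵛ       = here refl
∈-vecsOver ∈xs (x ∷ᵛ v) = ∈-concatMap (∈-map⁺ (x ∷ᵛ_) (∈-vecsOver ∈xs v)) (∈xs x)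

-- Maps X → X, stored as vectors of values along xs so that they can be enumerated.
module Transformations {X : Set} (xs : List X) (∈xs : ∀ x → x ∈ xs) where

  Transformation : Set
  Transformation = Vec X (length xs)

  apply : Transformation → X → X
  apply t x = lookup t (index (∈xs x))

  tabulateT : (X → X) → Transformation
  tabulateT φ = Vec.tabulate (φ ∘ List.lookup xs)

  apply-tabulateT : ∀ φ x → apply (tabulateT φ) x ≡ φ x
  apply-tabulateT φ x = trans (lookup∘tabulate _ (index (∈xs x))) (cong φ (sym (lookup-index (∈xs x))))

  transformations : List Transformation
  transformations = vecsOver xs (length xs)

  ∈-transformations : ∀ t → t ∈ transformations
  ∈-transformations = ∈-vecsOver ∈xs

-- Kernels

module Kernel {c ℓ} (K : Semiring c ℓ) {d} (Ss : Vec ANS d) (f : Vec ℕ d → Semiring.Carrier K) where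

  open Semiring K using (Carrier; 0#; _≈_; setoid)
    renaming (refl to ≈-refl; sym to ≈-sym; trans to ≈-trans; reflexive to ≈-reflexive)
  private
    Wd = List (Letter Ss)

  -- f extended by 0 outside 𝐋, so that (f ∘ w)(val u) = f⁰ (u ++ w).
  f⁰ : Wd → Carrier
  f⁰ u = if inBoldL Ss u then f (valB Ss u) else 0#

  f⁰-∈ : ∀ u → T (inBoldL Ss u) → f⁰ u ≡ f (valB Ss u)
  f⁰-∈ u u∈L with inBoldL Ss u
  ... | true = refl

  -- f ∘ w is n ↦ out (φ (state reached on rep n)) for the transformation φ = flip (run M) w.
  finiteKernel-fromDFAO : (M : FiniteDFAO (Letter Ss) Carrier) → (∀ u → f⁰ u ≈ output M u) →
                          FiniteKernel K Ss f
  finiteKernel-fromDFAO M computes = map kernelElem transformations , λ w →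
    lose (∈-map⁺ kernelElem (∈-transformations (tabulateT (flip (run M) w)))) (isKernelElem w)
    where
    open Transformations (states M) (∈-states M)
    kernelElem : Transformation → Vec ℕ d → Carrier
    kernelElem t n = out M (apply t (run M (start M) (repB Ss n)))
    isKernelElem : ∀ w → IsKernelElem K Ss f w (kernelElem (tabulateT (flip (run M) w)))
    isKernelElem w u u∈L = begin
      kernelElem tʷ (valB Ss u)
        ≡⟨ cong (λ v → out M (apply tʷ (run M (start M) v))) (repB-valB Ss u u∈L) ⟩
      out M (apply tʷ (run M (start M) u))
        ≡⟨ cong (out M) (apply-tabulateT (flip (run M) w) (run M (start M) u)) ⟩
      out M (run M (run M (start M) u) w)
        ≡⟨ cong (out M) (sym (foldl-++ (step M) (start M) u w)) ⟩
      output M (u ++ w)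
        ≈⟨ ≈-sym (computes (u ++ w)) ⟩
      f⁰ (u ++ w) ∎
      where
      open SetoidReasoning setoid hiding (start)
      tʷ = tabulateT (flip (run M) w)

  automatic⇒finiteKernel : Automatic K Ss f → FiniteKernel K Ss f
  automatic⇒finiteKernel (M , M-computes) = finiteKernel-fromDFAO M⁰ computes
    where
    M⁰ : FiniteDFAO (Letter Ss) Carrier
    M⁰ = zipWith (λ y b → if b then y else 0#) (fromDFAO M) (boldL-DFAO Ss)
    computes : ∀ u → f⁰ u ≈ output M⁰ u
    computes u rewrite output-zipWith (λ y b → if b then y else 0#) (fromDFAO M) (boldL-DFAO Ss) u
                     | output-boldL-DFAO Ss u with inBoldL Ss u | M-computes u
    ... | true  | M-computesᵤ = M-computesᵤ _
    ... | false | _           = ≈-refl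

  f⁰-∉ : ∀ u → ¬ T (inBoldL Ss u) → f⁰ u ≡ 0#
  f⁰-∉ u u∉L with inBoldL Ss u
  ... | true  = contradiction _ u∉L
  ... | false = refl

  _∼_ : Wd → Wd → Set ℓ
  w ∼ w' = ∀ u → T (inBoldL Ss u) → f⁰ (u ++ w) ≈ f⁰ (u ++ w')

  ≡⇒∼ : ∀ {w w'} → w ≡ w' → w ∼ w'
  ≡⇒∼ refl _ _ = ≈-refl

  ∼-trans : ∀ {w w' w''} → w ∼ w' → w' ∼ w'' → w ∼ w''
  ∼-trans w∼w' w'∼w'' u u∈L = ≈-trans (w∼w' u u∈L) (w'∼w'' u u∈L)

  sameKernelElem⇒∼ : ∀ {w w' g} → IsKernelElem K Ss f w g → IsKernelElem K Ss f w' g → w ∼ w'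
  sameKernelElem⇒∼ g≈f∘w g≈f∘w' u u∈L = ≈-trans (≈-sym (g≈f∘w u u∈L)) (g≈f∘w' u u∈L)

  -- Prefix-closedness is what makes ∼ a left congruence: if u ++ [ a ] ∉ 𝐋 then
  -- f⁰ vanishes on every extension of it.
  ∼-prepend : (∀ i → PrefixClosed (lookup Ss i)) → ∀ p {w w'} → w ∼ w' → (p ++ w) ∼ (p ++ w')
  ∼-prepend closed []      w∼w' = w∼w'
  ∼-prepend closed (a ∷ p) {w} {w'} w∼w' u u∈L with T? (inBoldL Ss (u ++ [ a ]))
  ... | yes ua∈L = begin
    f⁰ (u ++ a ∷ p ++ w)       ≡⟨ cong f⁰ (sym (++-assoc u [ a ] (p ++ w))) ⟩
    f⁰ ((u ++ [ a ]) ++ p ++ w)  ≈⟨ ∼-prepend closed p w∼w' (u ++ [ a ]) ua∈L ⟩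
    f⁰ ((u ++ [ a ]) ++ p ++ w') ≡⟨ cong f⁰ (++-assoc u [ a ] (p ++ w')) ⟩
    f⁰ (u ++ a ∷ p ++ w')      ∎
    where open SetoidReasoning setoid
  ... | no ua∉L = ≈-reflexive (trans (vanishes (p ++ w)) (sym (vanishes (p ++ w'))))
    where
    vanishes : ∀ v → f⁰ (u ++ a ∷ v) ≡ 0#
    vanishes v = f⁰-∉ (u ++ a ∷ v) λ uav∈L →
      ua∉L (inBoldL-prefix Ss closed (u ++ [ a ]) v
             (subst (T ∘ inBoldL Ss) (sym (++-assoc u [ a ] v)) uav∈L))

  module _ (closed : ∀ i → PrefixClosed (lookup Ss i)) (finite : FiniteKernel K Ss f) where

    private
      m = length (proj₁ finite)

    kernelIndex : Wd → Fin m
    kernelIndex w = index (proj₂ finite w)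

    sameKernelIndex⇒∼ : ∀ {w w'} → kernelIndex w ≡ kernelIndex w' → w ∼ w'
    sameKernelIndex⇒∼ {w} {w'} same =
      sameKernelElem⇒∼ {g = List.lookup (proj₁ finite) (kernelIndex w)} (lookup-index (proj₂ finite w))
        (subst (IsKernelElem K Ss f w' ∘ List.lookup (proj₁ finite)) (sym same) (lookup-index (proj₂ finite w')))

    -- Pigeonhole: two of the m + 1 suffixes drop 0 x, …, drop m x have the same kernel element.
    shorten : ∀ x → length x ≤ m → ∃ λ y → length y < m × y ∼ x
    shorten x |x|≤m with length x <? m
    ... | yes |x|<m = x , |x|<m , ≡⇒∼ refl
    ... | no  |x|≮m
      with i , j , i<j , same ← pigeonhole (n<1+n m) (λ (i : Fin (suc m)) → kernelIndex (drop (toℕ i) x)) =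
      take (toℕ i) x ++ drop (toℕ j) x ,
      |y|<m ,
      ∼-trans (∼-prepend closed (take (toℕ i) x) (sameKernelIndex⇒∼ (sym same)))
              (≡⇒∼ (take++drop≡id (toℕ i) x))
      where
      |x|≡m : length x ≡ m
      |x|≡m = ≤-antisym |x|≤m (≮⇒≥ |x|≮m)
      j≤|x| : toℕ j ≤ length x
      j≤|x| = subst (toℕ j ≤_) (sym |x|≡m) (toℕ≤pred[n] j)
      |y|<m : length (take (toℕ i) x ++ drop (toℕ j) x) < m
      |y|<m = begin-strict
        length (take (toℕ i) x ++ drop (toℕ j) x)
          ≡⟨ length-++ (take (toℕ i) x) ⟩
        length (take (toℕ i) x) + length (drop (toℕ j) x)
          ≡⟨ cong₂ _+_ (length-take (toℕ i) x) (length-drop (toℕ j) x) ⟩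
        toℕ i ⊓ length x + (length x ∸ toℕ j)
          ≤⟨ +-monoˡ-≤ _ (m⊓n≤m (toℕ i) (length x)) ⟩
        toℕ i + (length x ∸ toℕ j)
          <⟨ +-monoˡ-< _ i<j ⟩
        toℕ j + (length x ∸ toℕ j)
          ≡⟨ m+[n∸m]≡n j≤|x| ⟩
        length x
          ≡⟨ |x|≡m ⟩
        m ∎
        where open ≤-Reasoning

    shortEquivalent : ∀ x → ∃ λ y → length y < m × y ∼ x
    shortEquivalent []      = shorten [] z≤n
    shortEquivalent (a ∷ x) with y , |y|<m , y∼x ← shortEquivalent x
                            with z , |z|<m , z∼ay ← shorten (a ∷ y) |y|<m =
      z , |z|<m , ∼-trans z∼ay (∼-prepend closed [ a ] y∼x)

    representatives : List Wd
    representatives = listsShorterThan (letters Ss) m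

    Rep : Set
    Rep = Fin (length representatives)

    word : Rep → Wd
    word = List.lookup representatives

    canonical : Wd → Rep
    canonical x = let y , |y|<m , _ = shortEquivalent x in index (∈-listsShorterThan (∈-letters Ss) y |y|<m)

    word-canonical : ∀ x → word (canonical x) ∼ x
    word-canonical x = let y , |y|<m , y∼x = shortEquivalent x in
      ∼-trans (≡⇒∼ (sym (lookup-index (∈-listsShorterThan (∈-letters Ss) y |y|<m)))) y∼x

    open Transformations (allFin (length representatives)) ∈-allFin

    -- The state reached on p records how p acts on the ∼-classes of the short words.
    Tracks : Wd → Transformation → Set ℓ
    Tracks p t = ∀ j → word (apply t j) ∼ (p ++ word j)

    kernelDFAO : FiniteDFAO (Letter Ss) Carrier
    kernelDFAO = record
      { State = Transformation ; states = transformations ; ∈-states = ∈-transformations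
      ; start = tabulateT id
      ; step  = λ t a → tabulateT (apply t ∘ canonical ∘ (a ∷_) ∘ word)
      ; out   = λ t → f⁰ (word (apply t (canonical []))) }

    tracks-start : Tracks [] (tabulateT id)
    tracks-start j = ≡⇒∼ (cong word (apply-tabulateT id j))

    tracks-step : ∀ p t a → Tracks p t → Tracks (p ++ [ a ]) (step kernelDFAO t a)
    tracks-step p t a p-tracked j =
      ∼-trans (≡⇒∼ (cong word (apply-tabulateT (apply t ∘ canonical ∘ (a ∷_) ∘ word) j)))
     (∼-trans (p-tracked (canonical (a ∷ word j)))
     (∼-trans (∼-prepend closed p (word-canonical (a ∷ word j)))
              (≡⇒∼ (sym (++-assoc p [ a ] (word j))))))

    tracks-run : ∀ p t u → Tracks p t → Tracks (p ++ u) (run kernelDFAO t u)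
    tracks-run p t []      p-tracked = subst (λ q → Tracks q t) (sym (++-identityʳ p)) p-tracked
    tracks-run p t (a ∷ u) p-tracked = subst (λ q → Tracks q (run kernelDFAO t (a ∷ u))) (++-assoc p [ a ] u)
      (tracks-run (p ++ [ a ]) (step kernelDFAO t a) u (tracks-step p t a p-tracked))

    kernelDFAO-computes : ∀ u → T (inBoldL Ss u) → f (valB Ss u) ≈ output kernelDFAO u
    kernelDFAO-computes u u∈L = ≈-sym (≈-trans (final∼u [] (inBoldL-prefix Ss closed [] u u∈L))
                                              (≈-reflexive (f⁰-∈ u u∈L)))
      where
      final∼u : word (apply (run kernelDFAO (start kernelDFAO) u) (canonical [])) ∼ u
      final∼u = ∼-trans (tracks-run [] (tabulateT id) u tracks-start (canonical []))
               (∼-trans (∼-prepend closed u (word-canonical []))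
                        (≡⇒∼ (++-identityʳ u)))

  finiteKernel⇒automatic : (∀ i → PrefixClosed (lookup Ss i)) → FiniteKernel K Ss f → Automatic K Ss f
  finiteKernel⇒automatic closed finite = toDFAO M , λ u u∈L →
    ≈-trans (kernelDFAO-computes closed finite u u∈L) (≈-reflexive (sym (outDFAO-toDFAO M u)))
    where M = kernelDFAO closed finite

theorem6p4 : ∀ {c ℓ} (K : Semiring c ℓ) {d : ℕ} (Ss : Vec ANS d)
    (f : Vec ℕ d → Semiring.Carrier K) →
    (Automatic K Ss f → FiniteKernel K Ss f) ×
    ((∀ (i : Fin d) → PrefixClosed (lookup Ss i)) → FiniteKernel K Ss f → Automatic K Ss f)
theorem6p4 K Ss f = automatic⇒finiteKernel , finiteKernel⇒automatic
  where open Kernel K Ss f
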